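{- Let $(G,\mathbf{w})$ be a connected weighted graph with $n\ge 2$ vertices $v_1,\dots,v_n$ and let $w_{ij}=d_\mathbf{w}(v_i,v_j)$. Let $IP_1$ be the integer program $$\min \sum_{A\subseteq [n]} S_A \quad\text{s.t.}\quad \sum_{A\subseteq[n]:\ |A\cap\{i,j\}|=1} S_A \ge w_{ij}\ \ \forall\, 1\le i<j\le n,\qquad S_A\in\mathbb{Z}_{\ge 0}\ \ \forall A\subseteq[n],$$ and let $LP_1$ be its linear relaxation (same objective and constraints, with $S_A\in\mathbb{R}_{\ge 0}$). Then the integrality gap $\mathrm{OPT}(IP_1)/\mathrm{OPT}(LP_1)$ is at most $\lceil \log_2 n\rceil$.
   Context: A weighted graph $(G,\mathbf{w})$ is a finite simple graph with positive integer edge weights that is weight-minimal: every edge is a shortest path between its endpoints. $d_\mathbf{w}(u,v)$ is the minimum total weight of a $(u,v)$-path. $[n]=\{1,\dots,n\}$.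
   Formalization: The variables $S_A$ of the linear relaxation $LP_1$ take only nonnegative rational values rather than values in $\mathbb{R}_{\ge 0}$. -}

module Defs where

open import Data.Bool using (Bool; true; false; if_then_else_; _xor_)
open import Data.Nat using (ℕ; zero; suc; _+_; _≤_)
open import Data.Fin using (Fin)
open import Data.Vec using (Vec; []; _∷_; lookup)
open import Data.Fin.Subset using (Subset)
open import Data.List using (List; []; _∷_; map; _++_; foldr)
open import Data.Product using (Σ; _×_)
open import Data.Integer using (+_)
open import Data.Rational as ℚ using (ℚ; 0ℚ)
open import Relation.Binary.PropositionalEquality using (_≡_)

data Walk {n : ℕ} (adj : Fin n → Fin n → Bool) : Fin n → Fin n → Set where
  here : ∀ {u} → Walk adj u u
  step : ∀ {u x v} → adj u x ≡ true → Walk adj x v → Walk adj u v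

walkWeight : ∀ {n} {adj : Fin n → Fin n → Bool} (w : Fin n → Fin n → ℕ) {u v : Fin n} → Walk adj u v → ℕ
walkWeight w here = 0
walkWeight w (step {u} {x} _ p) = w u x + walkWeight w p

record WeightedGraph (n : ℕ) : Set where
  field
    adj : Fin n → Fin n → Bool
    adj-sym : ∀ i j → adj i j ≡ adj j i
    adj-irrefl : ∀ i → adj i i ≡ false
    w : Fin n → Fin n → ℕ
    w-sym : ∀ i j → adj i j ≡ true → w i j ≡ w j i
    w-pos : ∀ i j → adj i j ≡ true → 1 ≤ w i j
    weight-minimal : ∀ i j → adj i j ≡ true → (p : Walk adj i j) → w i j ≤ walkWeight w p

open WeightedGraph public

Connected : ∀ {n} → WeightedGraph n → Set
Connected G = ∀ i j → Walk (adj G) i j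

-- d is the weighted distance d_w: d i j is the minimum weight of an (i,j)-walk
-- (equivalently path, as weights are positive).
IsDistance : ∀ {n} → WeightedGraph n → (Fin n → Fin n → ℕ) → Set
IsDistance {n} G d = ∀ (i j : Fin n) →
  Σ (Walk (adj G) i j) (λ p → walkWeight (w G) p ≡ d i j)
  × (∀ (p : Walk (adj G) i j) → d i j ≤ walkWeight (w G) p)

allSubsets : ∀ n → List (Subset n)
allSubsets zero = [] ∷ []
allSubsets (suc n) = map (true ∷_) (allSubsets n) ++ map (false ∷_) (allSubsets n)

-- |A ∩ {i,j}| = 1
separates : ∀ {n} → Subset n → Fin n → Fin n → Bool
separates A i j = lookup A i xor lookup A j

sumℕ : List ℕ → ℕ
sumℕ = foldr _+_ 0

sumℚ : List ℚ → ℚ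
sumℚ = foldr ℚ._+_ 0ℚ

IPobj : ∀ {n} → (Subset n → ℕ) → ℕ
IPobj {n} S = sumℕ (map S (allSubsets n))

IPcut : ∀ {n} → (Subset n → ℕ) → Fin n → Fin n → ℕ
IPcut {n} S i j = sumℕ (map (λ A → if separates A i j then S A else 0) (allSubsets n))

IPfeasible : ∀ {n} → (Fin n → Fin n → ℕ) → (Subset n → ℕ) → Set
IPfeasible {n} d S = ∀ (i j : Fin n) → i Data.Fin.< j → d i j ≤ IPcut S i j

LPobj : ∀ {n} → (Subset n → ℚ) → ℚ
LPobj {n} x = sumℚ (map x (allSubsets n))

LPcut : ∀ {n} → (Subset n → ℚ) → Fin n → Fin n → ℚ
LPcut {n} x i j = sumℚ (map (λ A → if separates A i j then x A else 0ℚ) (allSubsets n))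

LPfeasible : ∀ {n} → (Fin n → Fin n → ℕ) → (Subset n → ℚ) → Set
LPfeasible {n} d x = (∀ A → 0ℚ ℚ.≤ x A)
  × (∀ (i j : Fin n) → i Data.Fin.< j → (+ d i j) ℚ./ 1 ℚ.≤ LPcut x i j)

toℚ : ℕ → ℚ
toℚ m = (+ m) ℚ./ 1

-- Let D be the largest demand d i j with i < j. Every LP cut is bounded by the LP objective,
-- so D ≤ OPT(LP₁). Conversely, since n ≤ 2 ^ ⌈log₂ n⌉, any two vertices differ in one of the
-- first ⌈log₂ n⌉ binary digits of their index, so the ⌈log₂ n⌉ cuts {i | bit k of i is 1},
-- each given weight D, form a feasible solution of IP₁ of cost ⌈log₂ n⌉ · D.

{-# OPTIONS --safe #-}
module Submission where

open import Defs
open import Data.Nat using (ℕ; _≤_)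
open import Data.Nat.Logarithm using (⌈log₂_⌉)
open import Data.Fin using (Fin)
open import Data.Fin.Subset using (Subset)
open import Data.Product using (Σ; _×_)
open import Data.Rational as ℚ using (ℚ)

open import Data.Bool using (Bool; true; false; if_then_else_; _xor_)
import Data.Bool.Properties as Boolₚ
open import Data.Fin as Fin using (toℕ)
import Data.Fin.Properties as Finₚ
import Data.Integer as ℤ
import Data.Integer.Properties as ℤₚ
import Data.Nat.Coprimality as Coprime
open import Data.List using (List; []; _∷_; _++_; map; length; upTo)
import Data.List.Properties as Listₚ
open import Data.List.Membership.Propositional using (_∈_)
open import Data.List.Membership.Propositional.Properties using (∈-map⁺; ∈-upTo⁺)
open import Data.List.Relation.Unary.Any using (here; there)
open import Data.Nat using (zero; suc; _+_; _*_; _^_; _<_; _⊔_; z≤n; s≤s; z<s; s<s; ⌊_/2⌋; ⌈_/2⌉)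
open import Data.Nat.ListAction using (sum)
open import Data.Nat.ListAction.Properties using (sum-++)
open import Data.Nat.Logarithm.Core using (⌈log2⌉)
import Data.Nat.Properties as ℕₚ
open import Algebra.Properties.CommutativeSemigroup ℕₚ.+-commutativeSemigroup using (interchange)
open import Data.Product using (∃-syntax; _,_)
open import Data.Sum using (inj₁; inj₂)
import Data.Rational.Properties as ℚₚ
open import Data.Vec using ([]; _∷_; tabulate)
open import Data.Vec.Properties using (≡-dec; ∷-injectiveʳ; lookup∘tabulate)
open import Function using (_∘_)
open import Induction.WellFounded using (Acc; acc)
open import Relation.Binary.Definitions using (DecidableEquality)
open import Relation.Binary.PropositionalEquality
open import Relation.Nullary using (does; yes; no; contradiction)
open import Relation.Nullary.Decidable using (dec-true; dec-false)

sum-map-+ : ∀ {A : Set} (f g : A → ℕ) (xs : List A) →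
            sum (map (λ a → f a + g a) xs) ≡ sum (map f xs) + sum (map g xs)
sum-map-+ f g []       = refl
sum-map-+ f g (x ∷ xs) = begin
  (f x + g x) + sum (map (λ a → f a + g a) xs)     ≡⟨ cong ((f x + g x) +_) (sum-map-+ f g xs) ⟩
  (f x + g x) + (sum (map f xs) + sum (map g xs))  ≡⟨ interchange (f x) (g x) _ _ ⟩
  (f x + sum (map f xs)) + (g x + sum (map g xs))  ∎
  where open ≡-Reasoning

sum-map-zero : ∀ {A : Set} (f : A → ℕ) (xs : List A) → (∀ a → f a ≡ 0) → sum (map f xs) ≡ 0
sum-map-zero f []       f≡0 = refl
sum-map-zero f (x ∷ xs) f≡0 = cong₂ _+_ (f≡0 x) (sum-map-zero f xs f≡0)

sum-map-mono-≤ : ∀ {A : Set} {f g : A → ℕ} (xs : List A) → (∀ a → f a ≤ g a) →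
                 sum (map f xs) ≤ sum (map g xs)
sum-map-mono-≤ []       f≤g = z≤n
sum-map-mono-≤ (x ∷ xs) f≤g = ℕₚ.+-mono-≤ (f≤g x) (sum-map-mono-≤ xs f≤g)

sum-allSubsets-suc : ∀ {n} (f : Subset (suc n) → ℕ) →
  sum (map f (allSubsets (suc n)))
    ≡ sum (map (f ∘ (true ∷_)) (allSubsets n)) + sum (map (f ∘ (false ∷_)) (allSubsets n))
sum-allSubsets-suc {n} f = begin
  sum (map f (map (true ∷_) As ++ map (false ∷_) As))
    ≡⟨ cong sum (Listₚ.map-++ f (map (true ∷_) As) _) ⟩
  sum (map f (map (true ∷_) As) ++ map f (map (false ∷_) As))
    ≡⟨ sum-++ (map f (map (true ∷_) As)) _ ⟩
  sum (map f (map (true ∷_) As)) + sum (map f (map (false ∷_) As))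
    ≡⟨ cong₂ (λ l r → sum l + sum r) (Listₚ.map-∘ As) (Listₚ.map-∘ As) ⟨
  sum (map (f ∘ (true ∷_)) As) + sum (map (f ∘ (false ∷_)) As)  ∎
  where
  open ≡-Reasoning
  As : List (Subset n)
  As = allSubsets n

sum-allSubsets-supported : ∀ {n} (f : Subset n → ℕ) (B : Subset n) → (∀ A → A ≢ B → f A ≡ 0) →
                           sum (map f (allSubsets n)) ≡ f B
sum-allSubsets-supported f [] _ = ℕₚ.+-identityʳ (f [])
sum-allSubsets-supported {suc n} f (true ∷ B) vanishes =
  trans (sum-allSubsets-suc f) (trans (cong₂ _+_ on-B off-B) (ℕₚ.+-identityʳ _))
  where
  on-B : sum (map (f ∘ (true ∷_)) (allSubsets n)) ≡ f (true ∷ B)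
  on-B = sum-allSubsets-supported (f ∘ (true ∷_)) B (λ A A≢B → vanishes _ (A≢B ∘ ∷-injectiveʳ))
  off-B : sum (map (f ∘ (false ∷_)) (allSubsets n)) ≡ 0
  off-B = sum-map-zero (f ∘ (false ∷_)) (allSubsets n) (λ A → vanishes _ λ ())
sum-allSubsets-supported {suc n} f (false ∷ B) vanishes =
  trans (sum-allSubsets-suc f) (cong₂ _+_ off-B on-B)
  where
  on-B : sum (map (f ∘ (false ∷_)) (allSubsets n)) ≡ f (false ∷ B)
  on-B = sum-allSubsets-supported (f ∘ (false ∷_)) B (λ A A≢B → vanishes _ (A≢B ∘ ∷-injectiveʳ))
  off-B : sum (map (f ∘ (true ∷_)) (allSubsets n)) ≡ 0
  off-B = sum-map-zero (f ∘ (true ∷_)) (allSubsets n) (λ A → vanishes _ λ ())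

_≟ₛ_ : ∀ {n} → DecidableEquality (Subset n)
_≟ₛ_ = ≡-dec Boolₚ._≟_

pointMass : ∀ {n} → Subset n → ℕ → Subset n → ℕ
pointMass B c A = if does (A ≟ₛ B) then c else 0

pointMass-self : ∀ {n} (B : Subset n) c → pointMass B c B ≡ c
pointMass-self B c rewrite dec-true (B ≟ₛ B) refl = refl

pointMass-vanishes : ∀ {n} {A B : Subset n} c → A ≢ B → pointMass B c A ≡ 0
pointMass-vanishes {A = A} {B} c A≢B rewrite dec-false (A ≟ₛ B) A≢B = refl

IPobj-pointMass : ∀ {n} (B : Subset n) c → IPobj (pointMass B c) ≡ c
IPobj-pointMass B c = trans (sum-allSubsets-supported (pointMass B c) B (λ A → pointMass-vanishes c)) (pointMass-self B c)

IPcut-pointMass : ∀ {n} (B : Subset n) c {i j} → separates B i j ≡ true → IPcut (pointMass B c) i j ≡ c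
IPcut-pointMass B c {i} {j} B-separates = trans (sum-allSubsets-supported _ B vanishes) on-B
  where
  vanishes : ∀ A → A ≢ B → (if separates A i j then pointMass B c A else 0) ≡ 0
  vanishes A A≢B rewrite pointMass-vanishes c A≢B = Boolₚ.if-eta (separates A i j)
  on-B : (if separates B i j then pointMass B c B else 0) ≡ c
  on-B rewrite B-separates = pointMass-self B c

IPobj-+ : ∀ {n} (S T : Subset n → ℕ) → IPobj (λ A → S A + T A) ≡ IPobj S + IPobj T
IPobj-+ {n} S T = sum-map-+ S T (allSubsets n)

IPcut-mono : ∀ {n} {S T : Subset n → ℕ} → (∀ A → S A ≤ T A) → ∀ i j → IPcut S i j ≤ IPcut T i j
IPcut-mono {n} S≤T i j = sum-map-mono-≤ (allSubsets n) (λ A → if-mono (separates A i j) (S≤T A))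
  where
  if-mono : ∀ b {x y} → x ≤ y → (if b then x else 0) ≤ (if b then y else 0)
  if-mono true  x≤y = x≤y
  if-mono false _   = z≤n

uniformCuts : ∀ {n} → List (Subset n) → ℕ → Subset n → ℕ
uniformCuts []       c A = 0
uniformCuts (B ∷ Bs) c A = pointMass B c A + uniformCuts Bs c A

IPobj-uniformCuts : ∀ {n} (Bs : List (Subset n)) c → IPobj (uniformCuts Bs c) ≡ length Bs * c
IPobj-uniformCuts {n} []       c = sum-map-zero (λ _ → 0) (allSubsets n) (λ _ → refl)
IPobj-uniformCuts     (B ∷ Bs) c =
  trans (IPobj-+ (pointMass B c) (uniformCuts Bs c)) (cong₂ _+_ (IPobj-pointMass B c) (IPobj-uniformCuts Bs c))

≤-IPcut-uniformCuts : ∀ {n} {Bs : List (Subset n)} {B} c {i j} → B ∈ Bs → separates B i j ≡ true →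
                      c ≤ IPcut (uniformCuts Bs c) i j
≤-IPcut-uniformCuts {Bs = B ∷ Bs} c {i} {j} (here refl) B-separates =
  subst (_≤ IPcut (uniformCuts (B ∷ Bs) c) i j) (IPcut-pointMass B c B-separates)
    (IPcut-mono (λ A → ℕₚ.m≤m+n (pointMass B c A) (uniformCuts Bs c A)) i j)
≤-IPcut-uniformCuts c {i} {j} (there B∈Bs) B-separates =
  ℕₚ.≤-trans (≤-IPcut-uniformCuts c B∈Bs B-separates) (IPcut-mono (λ A → ℕₚ.m≤n+m _ _) i j)

Separating : ∀ {n} → List (Subset n) → Set
Separating {n} Bs = ∀ {i j : Fin n} → i ≢ j → ∃[ B ] B ∈ Bs × separates B i j ≡ true

uniformCuts-feasible : ∀ {n} {Bs : List (Subset n)} (d : Fin n → Fin n → ℕ) c → Separating Bs →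
                       (∀ i j → i Fin.< j → d i j ≤ c) → IPfeasible d (uniformCuts Bs c)
uniformCuts-feasible d c separating d≤c i j i<j with separating (Finₚ.<⇒≢ i<j)
... | B , B∈Bs , B-separates = ℕₚ.≤-trans (d≤c i j i<j) (≤-IPcut-uniformCuts c B∈Bs B-separates)

odd : ℕ → Bool
odd zero          = false
odd (suc zero)    = true
odd (suc (suc m)) = odd m

bit : ℕ → ℕ → Bool
bit zero    m = odd m
bit (suc k) m = bit k ⌊ m /2⌋

odd-⌊/2⌋-injective : ∀ m m' → odd m ≡ odd m' → ⌊ m /2⌋ ≡ ⌊ m' /2⌋ → m ≡ m'
odd-⌊/2⌋-injective zero          zero           _    _     = refl
odd-⌊/2⌋-injective (suc zero)    (suc zero)     _    _     = refl
odd-⌊/2⌋-injective (suc (suc m)) (suc (suc m')) odd≡ half≡ =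
  cong (2 +_) (odd-⌊/2⌋-injective m m' odd≡ (ℕₚ.suc-injective half≡))
odd-⌊/2⌋-injective zero          (suc zero)     ()   _
odd-⌊/2⌋-injective (suc zero)    zero           ()   _
odd-⌊/2⌋-injective zero          (suc (suc _))  _    ()
odd-⌊/2⌋-injective (suc (suc _)) zero           _    ()
odd-⌊/2⌋-injective (suc zero)    (suc (suc _))  _    ()
odd-⌊/2⌋-injective (suc (suc _)) (suc zero)     _    ()

m<2*n⇒⌊m/2⌋<n : ∀ m n → m < 2 * n → ⌊ m /2⌋ < n
m<2*n⇒⌊m/2⌋<n m n m<2n = ℕₚ.*-cancelˡ-< 2 ⌊ m /2⌋ n (begin-strict
  2 * ⌊ m /2⌋            ≡⟨ cong (⌊ m /2⌋ +_) (ℕₚ.+-identityʳ ⌊ m /2⌋) ⟩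
  ⌊ m /2⌋ + ⌊ m /2⌋      ≤⟨ ℕₚ.+-monoʳ-≤ ⌊ m /2⌋ (ℕₚ.⌊n/2⌋≤⌈n/2⌉ m) ⟩
  ⌊ m /2⌋ + ⌈ m /2⌉      ≡⟨ ℕₚ.⌊n/2⌋+⌈n/2⌉≡n m ⟩
  m                      <⟨ m<2n ⟩
  2 * n                  ∎)
  where open ℕₚ.≤-Reasoning

bits-distinguish : ∀ L {m m'} → m < 2 ^ L → m' < 2 ^ L → m ≢ m' → ∃[ k ] k < L × bit k m ≢ bit k m'
bits-distinguish zero    (s≤s z≤n) (s≤s z≤n) m≢m' = contradiction refl m≢m'
bits-distinguish (suc L) {m} {m'} m<2^L m'<2^L m≢m' with odd m Boolₚ.≟ odd m'
... | no  odd-differs = zero , z<s , odd-differs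
... | yes odd-agrees  with bits-distinguish L (m<2*n⇒⌊m/2⌋<n m _ m<2^L) (m<2*n⇒⌊m/2⌋<n m' _ m'<2^L)
                             (m≢m' ∘ odd-⌊/2⌋-injective m m' odd-agrees)
...   | k , k<L , bit-differs = suc k , s<s k<L , bit-differs

bitCut : ∀ {n} → ℕ → Subset n
bitCut k = tabulate (bit k ∘ toℕ)

bitCuts : ∀ {n} → ℕ → List (Subset n)
bitCuts L = map bitCut (upTo L)

length-bitCuts : ∀ {n} L → length (bitCuts {n} L) ≡ L
length-bitCuts L = trans (Listₚ.length-map bitCut (upTo L)) (Listₚ.length-upTo L)

xor-≢ : ∀ {a b} → a ≢ b → a xor b ≡ true
xor-≢ {true}  {false} _   = refl
xor-≢ {false} {true}  _   = refl
xor-≢ {true}  {true}  a≢b = contradiction refl a≢b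
xor-≢ {false} {false} a≢b = contradiction refl a≢b

bitCut-separates : ∀ {n} k {i j : Fin n} → bit k (toℕ i) ≢ bit k (toℕ j) → separates (bitCut k) i j ≡ true
bitCut-separates k {i} {j} bits-differ
  rewrite lookup∘tabulate (bit k ∘ toℕ) i | lookup∘tabulate (bit k ∘ toℕ) j = xor-≢ bits-differ

bitCuts-separating : ∀ {n} L → n ≤ 2 ^ L → Separating (bitCuts {n} L)
bitCuts-separating L n≤2^L {i} {j} i≢j with
  bits-distinguish L (ℕₚ.<-≤-trans (Finₚ.toℕ<n i) n≤2^L) (ℕₚ.<-≤-trans (Finₚ.toℕ<n j) n≤2^L)
                     (i≢j ∘ Finₚ.toℕ-injective)
... | k , k<L , bits-differ = bitCut k , ∈-map⁺ bitCut (∈-upTo⁺ k<L) , bitCut-separates k bits-differ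

n≤2^⌈log2⌉n : ∀ n (rec : Acc _<_ n) → n ≤ 2 ^ ⌈log2⌉ n rec
n≤2^⌈log2⌉n zero          _       = z≤n
n≤2^⌈log2⌉n (suc zero)    _       = s≤s z≤n
n≤2^⌈log2⌉n (suc (suc n)) (acc _) = begin
  2 + n                          ≡⟨ cong (2 +_) (ℕₚ.⌊n/2⌋+⌈n/2⌉≡n n) ⟨
  2 + (⌊ n /2⌋ + ⌈ n /2⌉)        ≤⟨ ℕₚ.+-monoʳ-≤ 2 (ℕₚ.+-monoˡ-≤ ⌈ n /2⌉ (ℕₚ.⌊n/2⌋≤⌈n/2⌉ n)) ⟩
  2 + (⌈ n /2⌉ + ⌈ n /2⌉)        ≡⟨ cong (λ h → 2 + (⌈ n /2⌉ + h)) (ℕₚ.+-identityʳ ⌈ n /2⌉) ⟨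
  2 * 1 + 2 * ⌈ n /2⌉            ≡⟨ ℕₚ.*-distribˡ-+ 2 1 ⌈ n /2⌉ ⟨
  2 * suc ⌈ n /2⌉                ≤⟨ ℕₚ.*-monoʳ-≤ 2 (n≤2^⌈log2⌉n (suc ⌈ n /2⌉) _) ⟩
  2 * 2 ^ ⌈log2⌉ (suc ⌈ n /2⌉) _  ∎
  where open ℕₚ.≤-Reasoning

n≤2^⌈log₂n⌉ : ∀ n → n ≤ 2 ^ ⌈log₂ n ⌉
n≤2^⌈log₂n⌉ n = n≤2^⌈log2⌉n n _

maxᶠ : ∀ {m} → (Fin m → ℕ) → ℕ
maxᶠ {zero}  f = 0
maxᶠ {suc m} f = f Fin.zero ⊔ maxᶠ (f ∘ Fin.suc)

≤-maxᶠ : ∀ {m} (f : Fin m → ℕ) i → f i ≤ maxᶠ f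
≤-maxᶠ f Fin.zero    = ℕₚ.m≤m⊔n _ _
≤-maxᶠ f (Fin.suc i) = ℕₚ.≤-trans (≤-maxᶠ (f ∘ Fin.suc) i) (ℕₚ.m≤n⊔m _ _)

maxᶠ-closed : ∀ {m} (P : ℕ → Set) → P 0 → (f : Fin m → ℕ) → (∀ i → P (f i)) → P (maxᶠ f)
maxᶠ-closed {zero}  P P0 f Pf = P0
maxᶠ-closed {suc m} P P0 f Pf with ℕₚ.⊔-sel (f Fin.zero) (maxᶠ (f ∘ Fin.suc))
... | inj₁ max≡head = subst P (sym max≡head) (Pf Fin.zero)
... | inj₂ max≡tail = subst P (sym max≡tail) (maxᶠ-closed P P0 (f ∘ Fin.suc) (Pf ∘ Fin.suc))

upperDemand : ∀ {n} → (Fin n → Fin n → ℕ) → Fin n → Fin n → ℕ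
upperDemand d i j with i Fin.<? j
... | yes _ = d i j
... | no  _ = 0

maxDemand : ∀ {n} → (Fin n → Fin n → ℕ) → ℕ
maxDemand d = maxᶠ λ i → maxᶠ (upperDemand d i)

demand≤maxDemand : ∀ {n} (d : Fin n → Fin n → ℕ) i j → i Fin.< j → d i j ≤ maxDemand d
demand≤maxDemand d i j i<j = begin
  d i j                      ≡⟨ upperDemand-< ⟨
  upperDemand d i j          ≤⟨ ≤-maxᶠ (upperDemand d i) j ⟩
  maxᶠ (upperDemand d i)     ≤⟨ ≤-maxᶠ (λ i → maxᶠ (upperDemand d i)) i ⟩
  maxDemand d                ∎
  where
  open ℕₚ.≤-Reasoning
  upperDemand-< : upperDemand d i j ≡ d i j
  upperDemand-< with i Fin.<? j
  ... | yes _   = refl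
  ... | no  i≮j = contradiction i<j i≮j

sumℚ-map-mono-≤ : ∀ {A : Set} {f g : A → ℚ} (xs : List A) → (∀ a → f a ℚ.≤ g a) →
                  sumℚ (map f xs) ℚ.≤ sumℚ (map g xs)
sumℚ-map-mono-≤ []       f≤g = ℚₚ.≤-refl
sumℚ-map-mono-≤ (x ∷ xs) f≤g = ℚₚ.+-mono-≤ (f≤g x) (sumℚ-map-mono-≤ xs f≤g)

sumℚ-nonNeg : ∀ {A : Set} {f : A → ℚ} (xs : List A) → (∀ a → ℚ.0ℚ ℚ.≤ f a) → ℚ.0ℚ ℚ.≤ sumℚ (map f xs)
sumℚ-nonNeg []       f≥0 = ℚₚ.≤-refl
sumℚ-nonNeg (x ∷ xs) f≥0 = ℚₚ.+-mono-≤ (f≥0 x) (sumℚ-nonNeg xs f≥0)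

LPcut≤LPobj : ∀ {n} {x : Subset n → ℚ} → (∀ A → ℚ.0ℚ ℚ.≤ x A) → ∀ i j → LPcut x i j ℚ.≤ LPobj x
LPcut≤LPobj {n} {x} x≥0 i j = sumℚ-map-mono-≤ (allSubsets n) masked≤x
  where
  masked≤x : ∀ A → (if separates A i j then x A else ℚ.0ℚ) ℚ.≤ x A
  masked≤x A with separates A i j
  ... | true  = ℚₚ.≤-refl
  ... | false = x≥0 A

maxDemand≤LPobj : ∀ {n} {d : Fin n → Fin n → ℕ} {x : Subset n → ℚ} → LPfeasible d x →
                  toℚ (maxDemand d) ℚ.≤ LPobj x
maxDemand≤LPobj {n} {d} {x} (x≥0 , covers) =
  maxᶠ-closed Bounded LPobj≥0 _ λ i → maxᶠ-closed Bounded LPobj≥0 _ (demand-bounded i)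
  where
  Bounded : ℕ → Set
  Bounded m = toℚ m ℚ.≤ LPobj x
  LPobj≥0 : Bounded 0
  LPobj≥0 = sumℚ-nonNeg (allSubsets n) x≥0
  demand-bounded : ∀ i j → Bounded (upperDemand d i j)
  demand-bounded i j with i Fin.<? j
  ... | yes i<j = ℚₚ.≤-trans (covers i j i<j) (LPcut≤LPobj x≥0 i j)
  ... | no  _   = LPobj≥0

toℚ≡mkℚ : ∀ m → toℚ m ≡ ℚ.mkℚ (ℤ.+ m) 0 (Coprime.sym (Coprime.1-coprimeTo m))
toℚ≡mkℚ m = ℚₚ.normalize-coprime (Coprime.sym (Coprime.1-coprimeTo m))

toℚ-* : ∀ a b → toℚ (a * b) ≡ toℚ a ℚ.* toℚ b
toℚ-* a b rewrite toℚ≡mkℚ a | toℚ≡mkℚ b = cong (ℚ._/ 1) (ℤₚ.pos-* a b)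

proposition6 : (n : ℕ) → 2 ≤ n → (G : WeightedGraph n) → Connected G
    → (d : Fin n → Fin n → ℕ) → IsDistance G d
    → (x : Subset n → ℚ) → LPfeasible d x
    → Σ (Subset n → ℕ) (λ S → IPfeasible d S
        × toℚ (IPobj S) ℚ.≤ toℚ ⌈log₂ n ⌉ ℚ.* LPobj x)
proposition6 n _ _ _ d _ x x-feasible = S , S-feasible , S-cost
  where
  L D : ℕ
  L = ⌈log₂ n ⌉
  D = maxDemand d
  S : Subset n → ℕ
  S = uniformCuts (bitCuts L) D

  S-feasible : IPfeasible d S
  S-feasible = uniformCuts-feasible d D (bitCuts-separating L (n≤2^⌈log₂n⌉ n)) (demand≤maxDemand d)

  S-cost : toℚ (IPobj S) ℚ.≤ toℚ L ℚ.* LPobj x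
  S-cost = begin
    toℚ (IPobj S)                     ≡⟨ cong toℚ (IPobj-uniformCuts (bitCuts L) D) ⟩
    toℚ (length (bitCuts {n} L) * D)  ≡⟨ cong (λ l → toℚ (l * D)) (length-bitCuts L) ⟩
    toℚ (L * D)                       ≡⟨ toℚ-* L D ⟩
    toℚ L ℚ.* toℚ D                   ≤⟨ ℚₚ.*-monoˡ-≤-nonNeg (toℚ L) {{ℚₚ.normalize-nonNeg L 1}}
                                                             (maxDemand≤LPobj x-feasible) ⟩
    toℚ L ℚ.* LPobj x                 ∎
    where open ℚₚ.≤-Reasoning
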